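{- Let $\mathcal{Cl}$ be the class of disjoint unions of cliques and $\mathcal{G}$ the class of line graphs. Then $c_g^{\mathcal{Cl}}(\mathcal{G})=\infty$ and $c_\ell^{\mathcal{Cl}}(\mathcal{G})\leq2$.
   Context: All graphs are finite and simple. For a class $\mathcal{T}$ of graphs closed under disjoint union and a graph $G=(V,E)$, a cover of $G$ w.r.t. $\mathcal{T}$ is an edge-surjective graph homomorphism $\varphi$ from a disjoint union $T_1\dot{\cup}\cdots\dot{\cup}T_k$ with all $T_i\in\mathcal{T}$ to $G$; its size is $k$; it is injective if each restriction $\varphi|_{T_i}$ is injective. $c_g^{\mathcal{T}}(G)$ is the minimum size of an injective cover, and $c_\ell^{\mathcal{T}}(G)$ is the minimum over injective covers of $\max_{v\in V}|\varphi^{ -1}(v)|$. For a class $\mathcal{G}$ of graphs, $c_i^{\mathcal T}(\mathcal{G})=\sup\{c_i^{\mathcal T}(G):G\in\mathcal{G}\}$ for $i=g,\ell$. -}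

module Defs where

open import Data.Nat using (ℕ; _<_; _≤_)
open import Data.Bool using (Bool; true; false)
open import Data.Fin using (Fin; toℕ; _≟_)
open import Data.List using (List; length; filter; map; allFin)
open import Data.Nat.ListAction using (sum)
open import Data.Product using (Σ; _×_; Σ-syntax)
open import Data.Sum using (_⊎_)
open import Relation.Binary.PropositionalEquality using (_≡_; _≢_)
open import Relation.Nullary using (¬_)
open import Function using (_⇔_)
open import Function.Definitions using (Injective)

record Graph : Set where
  field
    n      : ℕ
    adj    : Fin n → Fin n → Bool
    sym    : ∀ u v → adj u v ≡ adj v u
    irrefl : ∀ u → adj u u ≡ false
open Graph public

V : Graph → Set
V G = Fin (n G)

E : (G : Graph) → V G → V G → Set
E G u v = adj G u v ≡ true

-- T is a disjoint union of
-- cliques iff its vertices can be labelled by (component) labels such that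
-- two distinct vertices are adjacent exactly when they carry the same label.
IsUnionOfCliques : Graph → Set
IsUnionOfCliques T =
  Σ[ c ∈ (V T → ℕ) ] (∀ u v → E T u v ⇔ (u ≢ v × c u ≡ c v))

IsEdgePair : (H : Graph) → V H × V H → Set
IsEdgePair H (a Data.Product., b) = (toℕ a < toℕ b) × E H a b

ShareEnd : {m : ℕ} → Fin m × Fin m → Fin m × Fin m → Set
ShareEnd (a₁ Data.Product., b₁) (a₂ Data.Product., b₂) =
  (a₁ ≡ a₂) ⊎ (a₁ ≡ b₂) ⊎ (b₁ ≡ a₂) ⊎ (b₁ ≡ b₂)

-- G is a line graph: G is isomorphic to L(H) for some graph H, i.e. there
-- is a bijection ε from V(G) onto E(H) such that two distinct vertices of G
-- are adjacent iff the corresponding edges of H share an endpoint.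
IsLineGraph : Graph → Set
IsLineGraph G =
  Σ[ H ∈ Graph ] Σ[ ε ∈ (V G → V H × V H) ]
    ( (∀ v → IsEdgePair H (ε v))
    × Injective _≡_ _≡_ ε
    × (∀ p → IsEdgePair H p → Σ[ v ∈ V G ] ε v ≡ p)
    × (∀ u v → E G u v ⇔ (u ≢ v × ShareEnd (ε u) (ε v))) )

-- A cover of G w.r.t. Cl: a homomorphism from T₁ ⊔ ... ⊔ T_k (each Tᵢ ∈ Cl)
-- to G that is edge-surjective; given componentwise as maps φ i : V(Tᵢ) → V(G).
record Cover (G : Graph) : Set where
  field
    size     : ℕ
    T        : Fin size → Graph
    inCl     : ∀ i → IsUnionOfCliques (T i)
    φ        : (i : Fin size) → V (T i) → V G
    hom      : ∀ i x y → E (T i) x y → E G (φ i x) (φ i y)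
    edgeSurj : ∀ u v → E G u v →
               Σ[ i ∈ Fin size ] Σ[ x ∈ V (T i) ] Σ[ y ∈ V (T i) ]
                 (E (T i) x y × φ i x ≡ u × φ i y ≡ v)
open Cover public

IsInjectiveCover : {G : Graph} → Cover G → Set
IsInjectiveCover C = ∀ i → Injective _≡_ _≡_ (φ C i)

preimageSize : {G : Graph} → Cover G → V G → ℕ
preimageSize C v =
  sum (map (λ i → length (filter (λ x → φ C i x ≟ v) (allFin (n (T C i)))))
           (allFin (size C)))

module Submission where

-- If G = L(H), then for every vertex x of H the
-- edges of H at x form a clique of G (a "star").  Covering G by the n(H)
-- stars, each mapped injectively, covers every edge of G, and a vertex e of
-- G (an edge of H) lies in exactly the two stars of its endpoints.
--
-- An injective Cl-cover of size s yields a clique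
-- layering of G: s partial equivalence relations whose classes are cliques
-- and which jointly cover all edges.  When G = L(H) with H triangle-free,
-- a layering induces a colouring of V(H) with 2^2^s colours that separates
-- x from y along every edge xy for which x has a further neighbour.  On the
-- shift graph (pairs i < j, with (i,j) ~ (j,l)), which is triangle-free,
-- such a colouring of pairs forces, by pigeonhole on the sets of colours
-- {c(i,j) : j > i}, M ≤ 2^2^2^s for M + 2 vertices.  Taking M > 2^2^2^k
-- therefore forces every injective cover to have more than k parts.

open import Defs
open import Data.Nat using (ℕ; _<_; _≤_)
open import Data.Product using (Σ; _×_; Σ-syntax)

open import Data.Nat using (zero; suc; z≤n; s≤s; _+_; _*_; _^_)
import Data.Nat.Properties as ℕP
open import Data.Bool using (true; false)
open import Data.Fin as F using (Fin; zero; suc; toℕ; combine; remQuot; funToFin; finToFun; _≟_)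
import Data.Fin.Properties as FP
open import Data.Product using (_,_; proj₁; proj₂)
open import Data.Sum using (_⊎_; inj₁; inj₂; [_,_]′)
open import Data.Empty using (⊥; ⊥-elim)
open import Data.List using (List; []; _∷_; length; filter; map; allFin; lookup)
open import Data.Nat.ListAction using (sum)
import Data.List.Properties as LP
import Data.List.Relation.Unary.All as All
open import Data.List.Relation.Unary.AllPairs using (_∷_)
open import Data.List.Relation.Unary.Unique.Propositional using (Unique)
import Data.List.Relation.Unary.Unique.Propositional.Properties as UniqueP
open import Data.List.Membership.Propositional using (_∈_)
import Data.List.Membership.Propositional.Properties as MembershipP
open import Data.List.Relation.Unary.Any using (here; there; index)
import Data.List.Relation.Unary.Any.Properties as AnyP
import Relation.Binary.PropositionalEquality
open Relation.Binary.PropositionalEquality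
  using (_≡_; _≢_; refl; trans; cong; subst; subst₂) renaming (sym to ≡-sym)
open import Relation.Binary using (tri<; tri≈; tri>)
open import Relation.Nullary using (Dec; yes; no; ¬_)
open import Relation.Nullary.Decidable using (⌊_⌋; _⊎-dec_; _×-dec_; ¬?)
open import Relation.Unary using (Decidable)
open import Function using (_⇔_; mk⇔; Equivalence; _∘_)
open import Function.Definitions using (Injective)

⌊⌋-true : ∀ {P : Set} (d : Dec P) → P → ⌊ d ⌋ ≡ true
⌊⌋-true (yes _) _ = refl
⌊⌋-true (no ¬p) p = ⊥-elim (¬p p)

⌊⌋-sound : ∀ {P : Set} (d : Dec P) → ⌊ d ⌋ ≡ true → P
⌊⌋-sound (yes p) _ = p
⌊⌋-sound (no _) ()

⌊⌋-false : ∀ {P : Set} (d : Dec P) → ¬ P → ⌊ d ⌋ ≡ false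
⌊⌋-false (yes p) ¬p = ⊥-elim (¬p p)
⌊⌋-false (no _) _ = refl

⌊⌋-cong : ∀ {P Q : Set} → (P → Q) → (Q → P) → (d : Dec P) (e : Dec Q) → ⌊ d ⌋ ≡ ⌊ e ⌋
⌊⌋-cong f g (yes p) e = ≡-sym (⌊⌋-true e (f p))
⌊⌋-cong f g (no ¬p) (yes q) = ⊥-elim (¬p (g q))
⌊⌋-cong f g (no _) (no _) = refl

edge-sym : ∀ (H : Graph) {a b} → E H a b → E H b a
edge-sym H {a} {b} p = trans (Graph.sym H b a) p

edge⇒distinct : ∀ (H : Graph) {a b} → E H a b → a ≢ b
edge⇒distinct H {a} ab refl with trans (≡-sym ab) (Graph.irrefl H a)
... | ()

module RelationGraph (N : ℕ) (R : Fin N → Fin N → Set) (R? : ∀ a b → Dec (R a b))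
    (R-sym : ∀ {a b} → R a b → R b a) (R-irrefl : ∀ a → ¬ R a a) where

  graph : Graph
  graph = record
    { n = N ; adj = λ a b → ⌊ R? a b ⌋
    ; sym = λ a b → ⌊⌋-cong R-sym R-sym (R? a b) (R? b a)
    ; irrefl = λ a → ⌊⌋-false (R? a a) (R-irrefl a) }

  edge⇔ : ∀ a b → E graph a b ⇔ R a b
  edge⇔ a b = mk⇔ (⌊⌋-sound (R? a b)) (⌊⌋-true (R? a b))

module Complete (m : ℕ) = RelationGraph m _≢_ (λ a b → ¬? (a ≟ b))
  (λ ne eq → ne (≡-sym eq)) (λ a ne → ne refl)

complete-inCl : ∀ m → IsUnionOfCliques (Complete.graph m)
complete-inCl m = (λ _ → 0) , λ u v →
  mk⇔ (λ uv → Equivalence.to (Complete.edge⇔ m u v) uv , refl)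
      (λ (u≢v , _) → Equivalence.from (Complete.edge⇔ m u v) u≢v)

module Enumerate {N : ℕ} {P : Fin N → Set} (P? : Decidable P) where
  elements : List (Fin N)
  elements = filter P? (allFin N)

  m : ℕ
  m = length elements

  g : Fin m → Fin N
  g = lookup elements

  g-sound : ∀ i → P (g i)
  g-sound i = proj₂ (MembershipP.∈-filter⁻ P? {xs = allFin N} (MembershipP.∈-lookup i))

  g-onto : ∀ x → P x → Σ[ i ∈ Fin m ] g i ≡ x
  g-onto x px = index x∈ , ≡-sym (AnyP.lookup-index x∈)
    where
    x∈ : x ∈ filter P? (allFin N)
    x∈ = MembershipP.∈-filter⁺ P? (MembershipP.∈-allFin x) px

  g-injective : Injective _≡_ _≡_ g
  g-injective {i} {j} = lookup-injective (UniqueP.filter⁺ P? (UniqueP.allFin⁺ N)) i j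
    where
    lookup-injective : ∀ {xs : List (Fin N)} → Unique xs → ∀ i j → lookup xs i ≡ lookup xs j → i ≡ j
    lookup-injective (_ ∷ _) zero zero _ = refl
    lookup-injective (x∉ ∷ _) zero (suc j) eq = ⊥-elim (All.lookup x∉ (MembershipP.∈-lookup j) eq)
    lookup-injective (x∉ ∷ _) (suc i) zero eq = ⊥-elim (All.lookup x∉ (MembershipP.∈-lookup i) (≡-sym eq))
    lookup-injective (_ ∷ u) (suc i) (suc j) eq = cong suc (lookup-injective u i j eq)

bit : ∀ {P : Set} → Dec P → Fin 2
bit (yes _) = suc zero
bit (no _) = zero

subsetCode : ∀ {N} {P : Fin N → Set} → Decidable P → Fin (2 ^ N)
subsetCode P? = funToFin (λ i → bit (P? i))

-- Subsets with equal codes are equal; we only need one inclusion.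
subsetCode-⊆ : ∀ {N} {P Q : Fin N → Set} (P? : Decidable P) (Q? : Decidable Q) →
               subsetCode P? ≡ subsetCode Q? → ∀ {i} → P i → Q i
subsetCode-⊆ P? Q? eq {i} p = bit-yes (P? i) (Q? i) p bits-equal
  where
  bits-equal : bit (P? i) ≡ bit (Q? i)
  bits-equal = trans (≡-sym (FP.finToFun-funToFin (λ i → bit (P? i)) i))
                 (trans (cong (λ c → finToFun c i) eq) (FP.finToFun-funToFin (λ i → bit (Q? i)) i))
  bit-yes : ∀ {A B : Set} (a? : Dec A) (b? : Dec B) → A → bit a? ≡ bit b? → B
  bit-yes _ (yes b) _ _ = b
  bit-yes (yes _) (no _) _ ()
  bit-yes (no ¬a) (no _) a _ = ⊥-elim (¬a a)

preimageCount : ∀ {m N} → (Fin m → Fin N) → Fin N → ℕ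
preimageCount {m} g v = length (filter (λ y → g y ≟ v) (allFin m))

preimageCount-injective : ∀ {m N} (g : Fin m → Fin N) → Injective _≡_ _≡_ g →
                          ∀ v → preimageCount g v ≤ 1
preimageCount-injective {m} g g-inj v =
  length-≤1 (UniqueP.filter⁺ (λ y → g y ≟ v) (UniqueP.allFin⁺ m)) all-equal
  where
  all-equal : ∀ {a b} → a ∈ filter (λ y → g y ≟ v) (allFin m) → b ∈ filter (λ y → g y ≟ v) (allFin m) → a ≡ b
  all-equal a∈ b∈ = g-inj (trans (proj₂ (MembershipP.∈-filter⁻ (λ y → g y ≟ v) {xs = allFin m} a∈))
                                 (≡-sym (proj₂ (MembershipP.∈-filter⁻ (λ y → g y ≟ v) {xs = allFin m} b∈))))
  length-≤1 : ∀ {A : Set} {xs : List A} → Unique xs → (∀ {a b} → a ∈ xs → b ∈ xs → a ≡ b) → length xs ≤ 1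
  length-≤1 {xs = []} _ _ = z≤n
  length-≤1 {xs = _ ∷ []} _ _ = s≤s z≤n
  length-≤1 {xs = _ ∷ _ ∷ _} ((x∉ All.∷ _) ∷ _) eq = ⊥-elim (x∉ (eq (here refl) (there (here refl))))

preimageCount-absent : ∀ {m N} (g : Fin m → Fin N) v → (∀ y → g y ≢ v) → preimageCount g v ≡ 0
preimageCount-absent {m} g v ∉img =
  cong length (LP.filter-none (λ y → g y ≟ v) {xs = allFin m} (All.tabulate (λ {y} _ → ∉img y)))

sum-≤-occurrences : ∀ {N} (f : Fin N → ℕ) (a b : Fin N) → (∀ x → f x ≤ 1) →
                    (∀ x → x ≢ a → x ≢ b → f x ≡ 0) → ∀ xs →
                    sum (map f xs) ≤ length (filter (_≟ a) xs) + length (filter (_≟ b) xs)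
sum-≤-occurrences f a b f≤1 f-supp [] = z≤n
sum-≤-occurrences f a b f≤1 f-supp (x ∷ xs)
  with x ≟ a | x ≟ b | sum-≤-occurrences f a b f≤1 f-supp xs
... | yes _ | yes _ | ih = ℕP.+-mono-≤ (f≤1 x) (ℕP.≤-trans ih (ℕP.+-monoʳ-≤ _ (ℕP.n≤1+n _)))
... | yes _ | no _  | ih = ℕP.+-mono-≤ (f≤1 x) ih
... | no _  | yes _ | ih = ℕP.≤-trans (ℕP.+-mono-≤ (f≤1 x) ih) (ℕP.≤-reflexive (≡-sym (ℕP.+-suc _ _)))
... | no x≢a | no x≢b | ih rewrite f-supp x x≢a x≢b = ih

-- Hence such a function sums to at most 2 over all of Fin N, since a and
-- b each occur once there (as their own preimages under the identity).
sum-supported-on-pair : ∀ {N} (f : Fin N → ℕ) (a b : Fin N) → (∀ x → f x ≤ 1) →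
                        (∀ x → x ≢ a → x ≢ b → f x ≡ 0) → sum (map f (allFin N)) ≤ 2
sum-supported-on-pair f a b f≤1 f-supp = ℕP.≤-trans (sum-≤-occurrences f a b f≤1 f-supp (allFin _))
  (ℕP.+-mono-≤ (preimageCount-injective (λ x → x) (λ eq → eq) a)
               (preimageCount-injective (λ x → x) (λ eq → eq) b))

InPair : ∀ {m} → Fin m → Fin m × Fin m → Set
InPair x (a , b) = x ≡ a ⊎ x ≡ b

at-most-two-entries : ∀ {m} {x y w : Fin m} (p : Fin m × Fin m) → InPair x p → InPair y p → InPair w p →
                      x ≢ y → x ≢ w → y ≢ w → ⊥
at-most-two-entries _ (inj₁ refl) (inj₁ refl) _ x≢y _ _ = x≢y refl
at-most-two-entries _ (inj₂ refl) (inj₂ refl) _ x≢y _ _ = x≢y refl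
at-most-two-entries _ (inj₁ refl) (inj₂ refl) (inj₁ refl) _ x≢w _ = x≢w refl
at-most-two-entries _ (inj₁ refl) (inj₂ refl) (inj₂ refl) _ _ y≢w = y≢w refl
at-most-two-entries _ (inj₂ refl) (inj₁ refl) (inj₁ refl) _ _ y≢w = y≢w refl
at-most-two-entries _ (inj₂ refl) (inj₁ refl) (inj₂ refl) _ x≢w _ = x≢w refl

edgePair-determined : ∀ {H : Graph} {x y} (p q : V H × V H) → IsEdgePair H p → IsEdgePair H q →
                      InPair x p → InPair y p → InPair x q → InPair y q → x ≢ y → p ≡ q
edgePair-determined _ _ _ _ (inj₁ refl) (inj₁ refl) _ _ x≢y = ⊥-elim (x≢y refl)
edgePair-determined _ _ _ _ (inj₂ refl) (inj₂ refl) _ _ x≢y = ⊥-elim (x≢y refl)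
edgePair-determined _ _ _ _ _ _ (inj₁ refl) (inj₁ refl) x≢y = ⊥-elim (x≢y refl)
edgePair-determined _ _ _ _ _ _ (inj₂ refl) (inj₂ refl) x≢y = ⊥-elim (x≢y refl)
edgePair-determined _ _ _ _ (inj₁ refl) (inj₂ refl) (inj₁ refl) (inj₂ refl) _ = refl
edgePair-determined _ _ _ _ (inj₂ refl) (inj₁ refl) (inj₂ refl) (inj₁ refl) _ = refl
edgePair-determined _ _ (a<b , _) (b<a , _) (inj₁ refl) (inj₂ refl) (inj₂ refl) (inj₁ refl) _ =
  ⊥-elim (ℕP.<-asym a<b b<a)
edgePair-determined _ _ (a<b , _) (b<a , _) (inj₂ refl) (inj₁ refl) (inj₁ refl) (inj₂ refl) _ =
  ⊥-elim (ℕP.<-asym a<b b<a)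

module LineGraph (G : Graph) (lg : IsLineGraph G) where
  H : Graph
  H = proj₁ lg

  ends : V G → V H × V H
  ends = proj₁ (proj₂ lg)

  ends-edge : ∀ e → IsEdgePair H (ends e)
  ends-edge = proj₁ (proj₂ (proj₂ lg))

  ends-injective : Injective _≡_ _≡_ ends
  ends-injective = proj₁ (proj₂ (proj₂ (proj₂ lg)))

  ends-onto : ∀ p → IsEdgePair H p → Σ[ e ∈ V G ] ends e ≡ p
  ends-onto = proj₁ (proj₂ (proj₂ (proj₂ (proj₂ lg))))

  adjacent⇔ : ∀ u v → E G u v ⇔ (u ≢ v × ShareEnd (ends u) (ends v))
  adjacent⇔ = proj₂ (proj₂ (proj₂ (proj₂ (proj₂ lg))))

  _∈ₑ_ : V H → V G → Set
  x ∈ₑ e = InPair x (ends e)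

  _∈ₑ?_ : ∀ x e → Dec (x ∈ₑ e)
  x ∈ₑ? e = (x ≟ proj₁ (ends e)) ⊎-dec (x ≟ proj₂ (ends e))

  endpoints-adjacent : ∀ {x y e} → x ∈ₑ e → y ∈ₑ e → x ≢ y → E H x y
  endpoints-adjacent {e = e} x∈ y∈ x≢y with ends e | ends-edge e | x∈ | y∈
  ... | _ | _ , ab | inj₁ refl | inj₁ refl = ⊥-elim (x≢y refl)
  ... | _ | _ , ab | inj₁ refl | inj₂ refl = ab
  ... | _ | _ , ab | inj₂ refl | inj₁ refl = edge-sym H ab
  ... | _ | _ , ab | inj₂ refl | inj₂ refl = ⊥-elim (x≢y refl)

  edge-determined : ∀ {x y e e'} → x ∈ₑ e → y ∈ₑ e → x ∈ₑ e' → y ∈ₑ e' → x ≢ y → e ≡ e'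
  edge-determined {e = e} {e'} xe ye xe' ye' x≢y =
    ends-injective (edgePair-determined {H} (ends e) (ends e') (ends-edge e) (ends-edge e') xe ye xe' ye' x≢y)

  edge-as-vertex : ∀ {x y} → E H x y → Σ[ e ∈ V G ] (x ∈ₑ e × y ∈ₑ e)
  edge-as-vertex {x} {y} xy with FP.<-cmp x y
  ... | tri< x<y _ _ = let (e , eq) = ends-onto (x , y) (x<y , xy)
                       in e , inj₁ (cong proj₁ (≡-sym eq)) , inj₂ (cong proj₂ (≡-sym eq))
  ... | tri≈ _ x≡y _ = ⊥-elim (edge⇒distinct H xy x≡y)
  ... | tri> _ _ y<x = let (e , eq) = ends-onto (y , x) (y<x , edge-sym H xy)
                       in e , inj₂ (cong proj₂ (≡-sym eq)) , inj₁ (cong proj₁ (≡-sym eq))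

  incident⇒adjacent : ∀ {x e e'} → e ≢ e' → x ∈ₑ e → x ∈ₑ e' → E G e e'
  incident⇒adjacent {x} {e} {e'} e≢e' xe xe' = Equivalence.from (adjacent⇔ e e') (e≢e' , share xe xe')
    where
    share : x ∈ₑ e → x ∈ₑ e' → ShareEnd (ends e) (ends e')
    share (inj₁ p) (inj₁ q) = inj₁ (trans (≡-sym p) q)
    share (inj₁ p) (inj₂ q) = inj₂ (inj₁ (trans (≡-sym p) q))
    share (inj₂ p) (inj₁ q) = inj₂ (inj₂ (inj₁ (trans (≡-sym p) q)))
    share (inj₂ p) (inj₂ q) = inj₂ (inj₂ (inj₂ (trans (≡-sym p) q)))

  adjacent⇒distinct : ∀ {e e'} → E G e e' → e ≢ e'
  adjacent⇒distinct {e} {e'} p = proj₁ (Equivalence.to (adjacent⇔ e e') p)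

  adjacent⇒common-endpoint : ∀ {e e'} → E G e e' → Σ[ z ∈ V H ] (z ∈ₑ e × z ∈ₑ e')
  adjacent⇒common-endpoint {e} {e'} p with proj₂ (Equivalence.to (adjacent⇔ e e') p)
  ... | inj₁ q = proj₁ (ends e) , inj₁ refl , inj₁ q
  ... | inj₂ (inj₁ q) = proj₁ (ends e) , inj₁ refl , inj₂ q
  ... | inj₂ (inj₂ (inj₁ q)) = proj₂ (ends e) , inj₂ refl , inj₁ q
  ... | inj₂ (inj₂ (inj₂ q)) = proj₂ (ends e) , inj₂ refl , inj₂ q

-- Upper bound: the star cover

module StarCover (G : Graph) (lg : IsLineGraph G) where
  open LineGraph G lg

  module Star (x : V H) = Enumerate (λ e → x ∈ₑ? e)

  cover : Cover G
  cover = record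
    { size = n H
    ; T = λ x → Complete.graph (Star.m x)
    ; inCl = λ x → complete-inCl (Star.m x)
    ; φ = Star.g
    ; hom = λ x a b ab → incident⇒adjacent
              (λ eq → Equivalence.to (Complete.edge⇔ (Star.m x) a b) ab (Star.g-injective x eq))
              (Star.g-sound x a) (Star.g-sound x b)
    ; edgeSurj = edge-in-star }
    where
    edge-in-star : ∀ u v → E G u v → Σ[ x ∈ V H ] Σ[ a ∈ Fin (Star.m x) ] Σ[ b ∈ Fin (Star.m x) ]
                     (E (Complete.graph (Star.m x)) a b × Star.g x a ≡ u × Star.g x b ≡ v)
    edge-in-star u v uv =
      let (z , zu , zv) = adjacent⇒common-endpoint uv
          (a , ga) = Star.g-onto z u zu
          (b , gb) = Star.g-onto z v zv
          a≢b : a ≢ b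
          a≢b = λ a≡b → adjacent⇒distinct uv (trans (≡-sym ga) (trans (cong (Star.g z) a≡b) gb))
      in z , a , b , Equivalence.from (Complete.edge⇔ (Star.m z) a b) a≢b , ga , gb

  injective : IsInjectiveCover cover
  injective = Star.g-injective

  -- A vertex e of G occurs only in the stars of the two endpoints of e.
  local : ∀ e → preimageSize cover e ≤ 2
  local e = sum-supported-on-pair (λ x → preimageCount (Star.g x) e) (proj₁ (ends e)) (proj₂ (ends e))
    (λ x → preimageCount-injective (Star.g x) (Star.g-injective x) e)
    (λ x x≢a x≢b → preimageCount-absent (Star.g x) e
       (λ y gy≡e → [ x≢a , x≢b ]′ (subst (x ∈ₑ_) gy≡e (Star.g-sound x y))))

local-cover-number-≤2 : (G : Graph) → IsLineGraph G →
  Σ[ C ∈ Cover G ] (IsInjectiveCover C × (∀ v → preimageSize C v ≤ 2))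
local-cover-number-≤2 G lg = cover , injective , local
  where open StarCover G lg

-- Clique layerings

record CliqueLayering (G : Graph) (s : ℕ) : Set₁ where
  field
    Same       : Fin s → V G → V G → Set
    Same?      : ∀ t u v → Dec (Same t u v)
    Same-sym   : ∀ {t u v} → Same t u v → Same t v u
    Same-trans : ∀ {t u v w} → Same t u v → Same t v w → Same t u w
    clique     : ∀ {t u v} → Same t u v → u ≢ v → E G u v
    covering   : ∀ {u v} → E G u v → Σ[ t ∈ Fin s ] Same t u v

-- An injective Cl-cover of size s is a clique layering with s layers: in
-- layer t, u and v are related when they are images of vertices of the
-- same clique of T t.
coverLayering : ∀ {G : Graph} (C : Cover G) → IsInjectiveCover C → CliqueLayering G (size C)
coverLayering {G} C inj = record
  { Same = Same ; Same? = Same? ; Same-sym = Same-sym ; Same-trans = Same-trans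
  ; clique = clique ; covering = covering }
  where
  colour : ∀ t → V (T C t) → ℕ
  colour t = proj₁ (inCl C t)

  Same : Fin (size C) → V G → V G → Set
  Same t u v = Σ[ x ∈ V (T C t) ] Σ[ y ∈ V (T C t) ]
                 (φ C t x ≡ u × φ C t y ≡ v × colour t x ≡ colour t y)

  Same? : ∀ t u v → Dec (Same t u v)
  Same? t u v = FP.any? λ x → FP.any? λ y →
    (φ C t x ≟ u) ×-dec (φ C t y ≟ v) ×-dec (colour t x Data.Nat.≟ colour t y)

  Same-sym : ∀ {t u v} → Same t u v → Same t v u
  Same-sym (x , y , px , py , c) = y , x , py , px , ≡-sym c

  -- Transitivity needs injectivity: v has a single preimage in T t.
  Same-trans : ∀ {t u v w} → Same t u v → Same t v w → Same t u w
  Same-trans {t} (x , y , px , py , c) (y' , z , py' , pz , c') =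
    x , z , px , pz , trans c (trans (cong (colour t) (inj t (trans py (≡-sym py')))) c')

  clique : ∀ {t u v} → Same t u v → u ≢ v → E G u v
  clique {t} (x , y , px , py , c) u≢v = subst₂ (E G) px py (hom C t x y
    (Equivalence.from (proj₂ (inCl C t) x y) ((λ x≡y → u≢v (trans (≡-sym px) (trans (cong (φ C t) x≡y) py))) , c)))

  covering : ∀ {u v} → E G u v → Σ[ t ∈ Fin (size C) ] Same t u v
  covering {u} {v} uv =
    let (t , x , y , xy , px , py) = edgeSurj C u v uv
    in t , x , y , px , py , proj₂ (Equivalence.to (proj₂ (inCl C t) x y) xy)

-- Lower bound: a layering of L(H), H triangle-free, colours H

TriangleFree : Graph → Set
TriangleFree H = ∀ {a b c} → E H a b → E H a c → E H b c → ⊥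

module LayeringColouring (G : Graph) (lg : IsLineGraph G) (△-free : TriangleFree (proj₁ lg))
    {s : ℕ} (L : CliqueLayering G s) where
  open LineGraph G lg
  open CliqueLayering L

  UsedAt : V H → V G → Fin s → Set
  UsedAt x e t = Σ[ e' ∈ V G ] (e' ≢ e × x ∈ₑ e' × Same t e e')

  UsedAt? : ∀ x e t → Dec (UsedAt x e t)
  UsedAt? x e t = FP.any? λ e' → ¬? (e' ≟ e) ×-dec (x ∈ₑ? e') ×-dec Same? t e e'

  -- Two edges at x are adjacent in G, hence share a layer used at x by both.
  shared-layer : ∀ {x e e'} → x ∈ₑ e → x ∈ₑ e' → e ≢ e' → Σ[ t ∈ Fin s ] (UsedAt x e t × UsedAt x e' t)
  shared-layer {e = e} {e'} xe xe' e≢e' =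
    let (t , same) = covering (incident⇒adjacent e≢e' xe xe')
    in t , (e' , (λ eq → e≢e' (≡-sym eq)) , xe' , same) , (e , e≢e' , xe , Same-sym same)

  -- The two ends x, y of an edge e use disjoint layers: if e₁ at x and e₂
  -- at y were both in the layer-t class of e, then e₁ and e₂ (distinct by
  -- edge-determined) would be adjacent in G, and e, e₁, e₂ would span a
  -- triangle of H.
  ends-use-disjoint-layers : ∀ {x y e t} → x ∈ₑ e → y ∈ₑ e → x ≢ y → UsedAt x e t → UsedAt y e t → ⊥
  ends-use-disjoint-layers {x} {y} {e} {t} xe ye x≢y (e₁ , e₁≢e , xe₁ , s₁) (e₂ , e₂≢e , ye₂ , s₂)
    with e₁ ≟ e₂
  ... | yes refl = e₁≢e (≡-sym (edge-determined xe ye xe₁ ye₂ x≢y))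
  ... | no e₁≢e₂ =
    let (z , ze₁ , ze₂) = adjacent⇒common-endpoint (clique (Same-trans (Same-sym s₁) s₂) e₁≢e₂)
        x≢z : x ≢ z
        x≢z = λ { refl → e₂≢e (≡-sym (edge-determined xe ye ze₂ ye₂ x≢y)) }
        y≢z : y ≢ z
        y≢z = λ { refl → e₁≢e (≡-sym (edge-determined xe ye xe₁ ze₁ x≢y)) }
    in △-free (endpoints-adjacent xe ye x≢y) (endpoints-adjacent xe₁ ze₁ x≢z)
              (endpoints-adjacent ye₂ ze₂ y≢z)

  -- The set of layers used by e at x, and the colour of x: the set of
  -- these sets over all edges e at x.
  profile : V H → V G → Fin (2 ^ s)
  profile x e = subsetCode (UsedAt? x e)

  HasProfile : V H → Fin (2 ^ s) → Set
  HasProfile x c = Σ[ e ∈ V G ] (x ∈ₑ e × profile x e ≡ c)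

  HasProfile? : ∀ x c → Dec (HasProfile x c)
  HasProfile? x c = FP.any? λ e → (x ∈ₑ? e) ×-dec (profile x e ≟ c)

  colour : V H → Fin (2 ^ 2 ^ s)
  colour x = subsetCode (HasProfile? x)

  -- If x lies on a further edge e₂ besides e = xy, the colours of x and y
  -- differ: the profile of e at y would be the profile at x of some edge e'
  -- at x, and e' shares with e (or with e₂, if e' = e) a layer used at x.
  colour-separates-edge : ∀ {x y e e₂} → x ∈ₑ e → y ∈ₑ e → x ≢ y → x ∈ₑ e₂ → e₂ ≢ e →
                          colour x ≢ colour y
  colour-separates-edge {x} {y} {e} {e₂} xe ye x≢y xe₂ e₂≢e same-colour =
    let (e' , xe' , same-profile) =
          subsetCode-⊆ (HasProfile? y) (HasProfile? x) (≡-sym same-colour) (e , ye , refl)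
    in layer-clash e' xe' (subsetCode-⊆ (UsedAt? x e') (UsedAt? y e) same-profile)
    where
    layer-clash : ∀ e' → x ∈ₑ e' → (∀ {t} → UsedAt x e' t → UsedAt y e t) → ⊥
    layer-clash e' xe' transfer with e' ≟ e
    ... | yes refl = let (t , used , _) = shared-layer xe xe₂ (λ eq → e₂≢e (≡-sym eq))
                     in ends-use-disjoint-layers xe ye x≢y used (transfer used)
    ... | no e'≢e = let (t , used , used') = shared-layer xe xe' (λ eq → e'≢e (≡-sym eq))
                    in ends-use-disjoint-layers xe ye x≢y used (transfer used')

  colour-separates : ∀ {x y w} → E H x y → E H x w → w ≢ y → colour x ≢ colour y
  colour-separates {x} {y} {w} xy xw w≢y with edge-as-vertex xy | edge-as-vertex xw
  ... | e , xe , ye | e₂ , xe₂ , we₂ = colour-separates-edge xe ye (edge⇒distinct H xy) xe₂ e₂≢e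
    where
    -- Otherwise w, x, y would be three distinct endpoints of e.
    e₂≢e : e₂ ≢ e
    e₂≢e e₂≡e = at-most-two-entries (ends e) xe ye (subst (w ∈ₑ_) e₂≡e we₂)
      (edge⇒distinct H xy) (edge⇒distinct H xw) (λ y≡w → w≢y (≡-sym y≡w))

module LineGraphOf (H : Graph) where
  private
    N = n H

  -- Vertices: the edge pairs of H, encoded in Fin (N * N).
  IsEdgeCode : Fin (N * N) → Set
  IsEdgeCode c = IsEdgePair H (remQuot {N} N c)

  IsEdgeCode? : ∀ c → Dec (IsEdgeCode c)
  IsEdgeCode? c = (toℕ (proj₁ (remQuot {N} N c)) Data.Nat.<? toℕ (proj₂ (remQuot {N} N c)))
    ×-dec (adj H (proj₁ (remQuot {N} N c)) (proj₂ (remQuot {N} N c)) Data.Bool.≟ true)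

  open Enumerate IsEdgeCode? using (m; g; g-sound; g-onto; g-injective)

  ends : Fin m → V H × V H
  ends i = remQuot {N} N (g i)

  ends-injective : Injective _≡_ _≡_ ends
  ends-injective {i} {j} eq = g-injective (begin
      g i                                       ≡⟨ ≡-sym (FP.combine-remQuot {N} N (g i)) ⟩
      combine (proj₁ (ends i)) (proj₂ (ends i)) ≡⟨ cong (λ p → combine (proj₁ p) (proj₂ p)) eq ⟩
      combine (proj₁ (ends j)) (proj₂ (ends j)) ≡⟨ FP.combine-remQuot {N} N (g j) ⟩
      g j                                       ∎)
    where open Relation.Binary.PropositionalEquality.≡-Reasoning

  ends-onto : ∀ p → IsEdgePair H p → Σ[ v ∈ Fin m ] ends v ≡ p
  ends-onto (a , b) ab =
    let (i , gi) = g-onto (combine a b) (subst (IsEdgePair H) (≡-sym (FP.remQuot-combine a b)) ab)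
    in i , trans (cong (remQuot {N} N) gi) (FP.remQuot-combine a b)

  ShareEnd? : ∀ (p q : V H × V H) → Dec (ShareEnd p q)
  ShareEnd? (a , b) (c , d) = (a ≟ c) ⊎-dec ((a ≟ d) ⊎-dec ((b ≟ c) ⊎-dec (b ≟ d)))

  ShareEnd-sym : ∀ (p q : V H × V H) → ShareEnd p q → ShareEnd q p
  ShareEnd-sym _ _ (inj₁ x) = inj₁ (≡-sym x)
  ShareEnd-sym _ _ (inj₂ (inj₁ x)) = inj₂ (inj₂ (inj₁ (≡-sym x)))
  ShareEnd-sym _ _ (inj₂ (inj₂ (inj₁ x))) = inj₂ (inj₁ (≡-sym x))
  ShareEnd-sym _ _ (inj₂ (inj₂ (inj₂ x))) = inj₂ (inj₂ (inj₂ (≡-sym x)))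

  Meet : Fin m → Fin m → Set
  Meet u v = u ≢ v × ShareEnd (ends u) (ends v)

  open RelationGraph m Meet (λ u v → ¬? (u ≟ v) ×-dec ShareEnd? (ends u) (ends v))
    (λ {u} {v} (u≢v , sh) → (λ eq → u≢v (≡-sym eq)) , ShareEnd-sym (ends u) (ends v) sh)
    (λ u (u≢u , _) → u≢u refl)
    using (graph; edge⇔) public

  isLineGraph : IsLineGraph graph
  isLineGraph = H , ends , g-sound , ends-injective , ends-onto , edge⇔

-- The shift graph

-- Vertices are pairs (i , j) of Fin M, encoded in Fin (M * M); (i , j) and
-- (j , l) are adjacent whenever i < j < l.  Pairs with i ≥ j are isolated.
module Shift (M : ℕ) where
  Step : Fin (M * M) → Fin (M * M) → Set
  Step p q = Step′ (remQuot {M} M p) (remQuot {M} M q)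
    where
    Step′ : Fin M × Fin M → Fin M × Fin M → Set
    Step′ (i , j) (j' , l) = i F.< j × j ≡ j' × j' F.< l

  Step? : ∀ p q → Dec (Step p q)
  Step? p q = (proj₁ (remQuot {M} M p) FP.<? proj₂ (remQuot {M} M p))
    ×-dec (proj₂ (remQuot {M} M p) ≟ proj₁ (remQuot {M} M q))
    ×-dec (proj₁ (remQuot {M} M q) FP.<? proj₂ (remQuot {M} M q))

  -- A step strictly increases the first entry, so there are no 3-cycles ...
  step-increasing : ∀ {p q} → Step p q → toℕ (proj₁ (remQuot {M} M p)) < toℕ (proj₁ (remQuot {M} M q))
  step-increasing (i<j , j≡j' , _) = subst (λ z → _ < toℕ z) j≡j' i<j

  no-3-cycle : ∀ {p q r} → Step p q → Step q r → Step r p → ⊥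
  no-3-cycle pq qr rp = ℕP.<-irrefl refl
    (ℕP.<-trans (step-increasing pq) (ℕP.<-trans (step-increasing qr) (step-increasing rp)))

  no-shortcut : ∀ {p q r} → Step p q → Step q r → Step p r → ⊥
  no-shortcut (_ , j≡j₁ , _) (j₁<l , l≡l₁ , _) (_ , j≡l₁ , _) =
    ℕP.<-irrefl (cong toℕ (trans (trans (≡-sym j≡j₁) j≡l₁) (≡-sym l≡l₁))) j₁<l

  step-irrefl : ∀ p → ¬ Step p p
  step-irrefl p (i<j , j≡i , _) = ℕP.<-irrefl (cong toℕ (≡-sym j≡i)) i<j

  Adjacent : Fin (M * M) → Fin (M * M) → Set
  Adjacent p q = Step p q ⊎ Step q p

  open RelationGraph (M * M) Adjacent (λ p q → Step? p q ⊎-dec Step? q p)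
    [ inj₂ , inj₁ ]′ (λ p → [ step-irrefl p , step-irrefl p ]′)
    using (graph; edge⇔) public

  -- Every orientation of a triangle has a 3-cycle or a shortcut.
  triangleFree : TriangleFree graph
  triangleFree {a} {b} {c} ab ac bc =
    orientations (to ab) (to ac) (to bc)
    where
    to : ∀ {p q} → E graph p q → Adjacent p q
    to {p} {q} = Equivalence.to (edge⇔ p q)
    orientations : Adjacent a b → Adjacent a c → Adjacent b c → ⊥
    orientations (inj₁ x) (inj₁ y) (inj₁ w) = no-shortcut x w y
    orientations (inj₁ x) (inj₁ y) (inj₂ w) = no-shortcut y w x
    orientations (inj₁ x) (inj₂ y) (inj₁ w) = no-3-cycle x w y
    orientations (inj₁ x) (inj₂ y) (inj₂ w) = no-shortcut y x w
    orientations (inj₂ x) (inj₁ y) (inj₁ w) = no-shortcut x y w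
    orientations (inj₂ x) (inj₁ y) (inj₂ w) = no-3-cycle x y w
    orientations (inj₂ x) (inj₂ y) (inj₁ w) = no-shortcut w y x
    orientations (inj₂ x) (inj₂ y) (inj₂ w) = no-shortcut w x y

  pair : Fin M → Fin M → Fin (M * M)
  pair = combine

  pair-injectiveˡ : ∀ {i j k l} → pair i j ≡ pair k l → i ≡ k
  pair-injectiveˡ {i} {j} {k} {l} = FP.combine-injectiveˡ i j k l

  shift-edge : ∀ {i j l} → i F.< j → j F.< l → E graph (pair i j) (pair j l)
  shift-edge {i} {j} {l} i<j j<l = Equivalence.from (edge⇔ (pair i j) (pair j l))
    (inj₁ (subst₂ (λ p q → proj₁ p F.< proj₂ p × proj₂ p ≡ proj₁ q × proj₁ q F.< proj₂ q)
                  (≡-sym (FP.remQuot-combine i j)) (≡-sym (FP.remQuot-combine j l))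
                  (i<j , refl , j<l)))

-- Let c colour the pairs of Fin (suc M) so that c i j ≢ c j l whenever
-- 0 < i < j < l.  Then the colour sets {c i j : i < j} of the M positive
-- indices are pairwise distinct, so M ≤ 2 ^ K.
shift-colouring-bound : ∀ {M K} (c : Fin (suc M) → Fin (suc M) → Fin K) →
                        (∀ {i j l} → zero {n = M} F.< i → i F.< j → j F.< l → c i j ≢ c j l) → M ≤ 2 ^ K
shift-colouring-bound {M} {K} c proper = ℕP.≮⇒≥ λ 2^K<M →
  let (i , j , i<j , same) = FP.pigeonhole 2^K<M (colourSet ∘ suc)
  in distinct (s≤s z≤n) (s≤s i<j) same
  where
  LaterColour : Fin (suc M) → Fin K → Set
  LaterColour i d = Σ[ j ∈ Fin (suc M) ] (i F.< j × c i j ≡ d)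

  LaterColour? : ∀ i d → Dec (LaterColour i d)
  LaterColour? i d = FP.any? λ j → (i FP.<? j) ×-dec (c i j ≟ d)

  colourSet : Fin (suc M) → Fin (2 ^ K)
  colourSet i = subsetCode (LaterColour? i)

  -- c i j lies in the set of i; were it in the set of j, some c j l would
  -- equal c i j.
  distinct : ∀ {i j} → zero {n = M} F.< i → i F.< j → colourSet i ≢ colourSet j
  distinct {i} {j} 0<i i<j same =
    let (l , j<l , c≡) = subsetCode-⊆ (LaterColour? i) (LaterColour? j) same (j , i<j , refl)
    in proper 0<i i<j j<l (≡-sym c≡)

module ShiftLineGraph (M : ℕ) where
  open Shift (suc (suc M)) using (pair; pair-injectiveˡ; shift-edge; triangleFree)

  S : Graph
  S = Shift.graph (suc (suc M))

  open LineGraphOf S using (graph; isLineGraph) public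

  cover-size-bound : (C : Cover graph) → IsInjectiveCover C → suc M ≤ 2 ^ 2 ^ 2 ^ size C
  cover-size-bound C inj = shift-colouring-bound (λ i j → colour (pair i j)) separated
    where
    open LayeringColouring graph isLineGraph (λ {a} {b} {c} → triangleFree {a} {b} {c})
      (coverLayering C inj) using (colour; colour-separates)
    -- (i , j) has the further neighbour (0 , i) besides (j , l).
    separated : ∀ {i j l} → zero {n = suc M} F.< i → i F.< j → j F.< l → colour (pair i j) ≢ colour (pair j l)
    separated {i} {j} {l} 0<i i<j j<l = colour-separates {pair i j} {pair j l} {pair zero i}
      (shift-edge {i} {j} {l} i<j j<l) (edge-sym S {pair zero i} {pair i j} (shift-edge 0<i i<j))
      (λ eq → FP.<⇒≢ (FP.<-trans 0<i i<j) (pair-injectiveˡ eq))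

cover-number-unbounded : (k : ℕ) →
  Σ[ G ∈ Graph ] (IsLineGraph G × ((C : Cover G) → IsInjectiveCover C → k < size C))
cover-number-unbounded k = graph , isLineGraph , λ C inj → ℕP.≰⇒> λ size≤k →
  ℕP.<-irrefl refl (ℕP.≤-trans (cover-size-bound C inj) (tower-mono size≤k))
  where
  open ShiftLineGraph (2 ^ 2 ^ 2 ^ k) using (graph; isLineGraph; cover-size-bound)
  tower-mono : ∀ {a b} → a ≤ b → 2 ^ 2 ^ 2 ^ a ≤ 2 ^ 2 ^ 2 ^ b
  tower-mono a≤b = ℕP.^-monoʳ-≤ 2 (ℕP.^-monoʳ-≤ 2 (ℕP.^-monoʳ-≤ 2 a≤b))

theorem21 : ((k : ℕ) → Σ[ G ∈ Graph ] (IsLineGraph G × ((C : Cover G) → IsInjectiveCover C → k < size C)))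
    × ((G : Graph) → IsLineGraph G → Σ[ C ∈ Cover G ] (IsInjectiveCover C × (∀ v → preimageSize C v ≤ 2)))
theorem21 = cover-number-unbounded , local-cover-number-≤2
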